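{- Let $A$ be a commutative ring with unity, let $D\subseteq A[z]$ be Diophantine over $A[z]$, and let $\alpha\ge0$ be an integer. Then both $\mathrm{Zero}(D_\alpha)$ and $\mathrm{Zero}(D)$ are countable unions of subsets of $A$ that are Diophantine over $A$.
   Context: For a ring $R$, a set $X\subseteq R^n$ is Diophantine over $R$ if there are polynomials $F_1,\dots,F_r\in R[x_1,\dots,x_n,y_1,\dots,y_m]$ such that $X=\{\mathbf a\in R^n:\exists \mathbf b\in R^m,\ F_j(\mathbf a,\mathbf b)=0 \text{ for all } j\}$. For $S\subseteq A[z]$, $S_\alpha=\{f\in S:\deg f\le\alpha\}$ and $\mathrm{Zero}(S)=\{a\in A: f(a)=0 \text{ for some } f\in S\}$. -}

module Defs where

open import Level using (Level; _⊔_) renaming (suc to lsuc)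
open import Data.Nat as ℕ using (ℕ; zero; suc)
open import Data.Fin using (Fin)
open import Data.List using (List; []; _∷_; map)
open import Data.Vec using (Vec; []; _∷_; _++_; lookup)
open import Data.Vec.Relation.Unary.All using (All)
open import Data.Product using (Σ; ∃; _×_)
open import Function.Bundles using (_⇔_)
open import Algebra.Bundles using (CommutativeRing)
open import Algebra.Bundles.Raw using (RawRing)

data Expr {c} (C : Set c) (n : ℕ) : Set c where
  const : C → Expr C n
  var   : Fin n → Expr C n
  _⊕_   : Expr C n → Expr C n → Expr C n
  _⊗_   : Expr C n → Expr C n → Expr C n
  ⊝_    : Expr C n → Expr C n

module _ {c ℓ} (R : RawRing c ℓ) where
  open RawRing R

  ⟦_⟧ : ∀ {n} → Expr Carrier n → Vec Carrier n → Carrier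
  ⟦ const a ⟧ ρ = a
  ⟦ var i ⟧   ρ = lookup ρ i
  ⟦ e ⊕ f ⟧   ρ = ⟦ e ⟧ ρ + ⟦ f ⟧ ρ
  ⟦ e ⊗ f ⟧   ρ = ⟦ e ⟧ ρ * ⟦ f ⟧ ρ
  ⟦ ⊝ e ⟧     ρ = - ⟦ e ⟧ ρ

  Diophantine : ∀ {p} (n : ℕ) → (Vec Carrier n → Set p) → Set (c ⊔ ℓ ⊔ p)
  Diophantine n X =
    Σ ℕ λ m → Σ ℕ λ r → Σ (Vec (Expr Carrier (n ℕ.+ m)) r) λ F →
      ∀ (a : Vec Carrier n) →
        X a ⇔ (Σ (Vec Carrier m) λ b → All (λ Fj → ⟦ Fj ⟧ (a ++ b) ≈ 0#) F)

  Diophantine₁ : ∀ {p} → (Carrier → Set p) → Set (c ⊔ ℓ ⊔ p)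
  Diophantine₁ X = Diophantine 1 (λ { (x ∷ []) → X x })

-- The polynomial ring A[z], polynomials as coefficient lists
-- (constant term first), equality = coefficientwise with zero padding.

module Poly {c ℓ} (A : CommutativeRing c ℓ) where
  open CommutativeRing A

  Pol : Set c
  Pol = List Carrier

  coeff : Pol → ℕ → Carrier
  coeff []      _       = 0#
  coeff (a ∷ p) zero    = a
  coeff (a ∷ p) (suc i) = coeff p i

  _≈ₚ_ : Pol → Pol → Set ℓ
  p ≈ₚ q = ∀ i → coeff p i ≈ coeff q i

  _+ₚ_ : Pol → Pol → Pol
  []      +ₚ q       = q
  (a ∷ p) +ₚ []      = a ∷ p
  (a ∷ p) +ₚ (b ∷ q) = (a + b) ∷ (p +ₚ q)

  -ₚ_ : Pol → Pol
  -ₚ p = map -_ p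

  _*ₚ_ : Pol → Pol → Pol
  []      *ₚ q = []
  (a ∷ p) *ₚ q = map (a *_) q +ₚ (0# ∷ (p *ₚ q))

  A[z] : RawRing c ℓ
  A[z] = record
    { Carrier = Pol ; _≈_ = _≈ₚ_ ; _+_ = _+ₚ_ ; _*_ = _*ₚ_ ; -_ = -ₚ_
    ; 0# = [] ; 1# = 1# ∷ [] }

  evalP : Pol → Carrier → Carrier
  evalP []      x = 0#
  evalP (a ∷ p) x = a + x * evalP p x

  -- deg f ≤ α  (the zero polynomial has degree ≤ α for every α)
  Deg≤ : ℕ → Pol → Set ℓ
  Deg≤ α f = ∀ i → α ℕ.< i → coeff f i ≈ 0#

  Trunc : ∀ {p} → (Pol → Set p) → ℕ → Pol → Set (ℓ ⊔ p)
  Trunc S α f = S f × Deg≤ α f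

  Zero : ∀ {p} → (Pol → Set p) → Carrier → Set (c ⊔ ℓ ⊔ p)
  Zero S a = Σ Pol λ f → S f × (evalP f a ≈ 0#)

  CountableUnionOfDiophantine : ∀ {p} → (Carrier → Set p) → Set (lsuc (c ⊔ ℓ) ⊔ p)
  CountableUnionOfDiophantine Y =
    Σ (ℕ → Set (c ⊔ ℓ)) λ I → Σ (ℕ → Carrier → Set (c ⊔ ℓ)) λ X →
      (∀ k → I k → Diophantine₁ rawRing (X k)) ×
      (∀ a → Y a ⇔ (Σ ℕ λ k → I k × X k a))

-- A polynomial f ∈ A[z] with deg f < l is its coefficient vector in A^l, and
-- an identity between polynomials whose coefficients are polynomial expressions
-- in finitely many elements of A is the finite system of equations saying that
-- each coefficient vanishes. So once the degrees of f and of the witnesses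
-- b₁, …, bₘ of "f ∈ D" are bounded, the condition "f(a) = 0 for such an f"
-- becomes a Diophantine condition on a over A. Letting the bounds run through ℕ
-- (and fixing the bound α on f for D_α) covers Zero(D_α) and Zero(D).
module Submission where

open import Defs
open import Level using (_⊔_)
open import Data.Nat using (ℕ)
open import Data.List using (List)
open import Data.Product using (_×_)
open import Algebra.Bundles using (CommutativeRing)

import Data.Nat as ℕ
open import Data.Nat using (zero; suc; z≤n; s≤s; _≤_)
open import Data.Nat.Properties using (≤-trans; ≤-refl; m≤m⊔n; m≤n⊔m)
import Data.Fin as Fin
import Data.List as L
open import Data.List using ([]; _∷_; length)
import Data.List.Properties as LP
import Data.List.Relation.Unary.All as LA
import Data.List.Relation.Unary.All.Properties as LAP
import Data.Vec as V
open import Data.Vec using (Vec; []; _∷_; _++_; toList; lookup)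
import Data.Vec.Properties as VP
import Data.Vec.Relation.Unary.All as VA
import Data.Vec.Relation.Unary.All.Properties as VAP
open import Data.Vec.Relation.Binary.Pointwise.Inductive as Pointwise using (Pointwise; []; _∷_)
open import Data.Product using (Σ; _,_)
open import Data.Unit.Polymorphic using (⊤; tt)
open import Function using (_∘_)
open import Function.Bundles using (_⇔_; mk⇔; Equivalence)
import Relation.Binary.PropositionalEquality as ≡
open ≡ using (_≡_)

module _ {a} {X : Set a} where

  take-++ : ∀ {m n} (u : Vec X m) (v : Vec X n) → V.take m (u ++ v) ≡ u
  take-++ {m} u v = VP.++-injectiveˡ (V.take m (u ++ v)) u (VP.take++drop≡id m (u ++ v))

  drop-++ : ∀ {m n} (u : Vec X m) (v : Vec X n) → V.drop m (u ++ v) ≡ v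
  drop-++ {m} u v = VP.++-injectiveʳ (V.take m (u ++ v)) u (VP.take++drop≡id m (u ++ v))

  chunks : ∀ {k} (ls : Vec ℕ k) → Vec X (V.sum ls) → Vec (List X) k
  chunks []       w = []
  chunks (l ∷ ls) w = toList (V.take l w) ∷ chunks ls (V.drop l w)

  pad : X → (l : ℕ) → List X → Vec X l
  pad d zero    xs       = []
  pad d (suc l) []       = d ∷ pad d l []
  pad d (suc l) (x ∷ xs) = x ∷ pad d l xs

  pack : X → ∀ {k} (ls : Vec ℕ k) → Vec (List X) k → Vec X (V.sum ls)
  pack d []       []       = []
  pack d (l ∷ ls) (p ∷ ps) = pad d l p ++ pack d ls ps

  maxLength : ∀ {k} → Vec (List X) k → ℕ
  maxLength []       = 0
  maxLength (p ∷ ps) = length p ℕ.⊔ maxLength ps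

chunks-map : ∀ {a b} {X : Set a} {Y : Set b} (g : X → Y) {k} (ls : Vec ℕ k) (w : Vec X (V.sum ls)) →
  V.map (L.map g) (chunks ls w) ≡ chunks ls (V.map g w)
chunks-map g []       w = ≡.refl
chunks-map g (l ∷ ls) w = ≡.cong₂ _∷_ head-chunk tail-chunks
  where
  open ≡.≡-Reasoning
  head-chunk : L.map g (toList (V.take l w)) ≡ toList (V.take l (V.map g w))
  head-chunk = begin
    L.map g (toList (V.take l w))  ≡⟨ VP.toList-map g (V.take l w) ⟨
    toList (V.map g (V.take l w))  ≡⟨ ≡.cong toList (VP.take-map g l w) ⟨
    toList (V.take l (V.map g w))  ∎
  tail-chunks : V.map (L.map g) (chunks ls (V.drop l w)) ≡ chunks ls (V.drop l (V.map g w))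
  tail-chunks = begin
    V.map (L.map g) (chunks ls (V.drop l w))  ≡⟨ chunks-map g ls (V.drop l w) ⟩
    chunks ls (V.map g (V.drop l w))          ≡⟨ ≡.cong (chunks ls) (VP.drop-map g l w) ⟨
    chunks ls (V.drop l (V.map g w))          ∎

module ZeroSets {c ℓ} (A : CommutativeRing c ℓ) where
  open CommutativeRing A hiding (zero)
  open Poly A
  open import Algebra.Properties.Ring ring using (-0#≈0#)

  ⟦_⟧ₚ : ∀ {n} → Expr Pol n → Vec Pol n → Pol
  ⟦_⟧ₚ = ⟦_⟧ A[z]

  evalExpr : ∀ {n} → Vec Carrier n → Expr Carrier n → Carrier
  evalExpr ρ e = ⟦_⟧ rawRing e ρ

  Vanishes : ∀ {n} → Vec Carrier n → Expr Carrier n → Set ℓ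
  Vanishes ρ e = evalExpr ρ e ≈ 0#

  -- ≈ₚ wrapped in a record, so that the polynomials can be inferred from a proof.
  record _≋_ (p q : Pol) : Set ℓ where
    constructor ⟨_⟩
    field coeff-≈ : p ≈ₚ q
  open _≋_

  ≋-refl : ∀ {p} → p ≋ p
  ≋-refl = ⟨ (λ _ → refl) ⟩

  ≋-sym : ∀ {p q} → p ≋ q → q ≋ p
  ≋-sym h = ⟨ sym ∘ coeff-≈ h ⟩

  ≋-trans : ∀ {p q s} → p ≋ q → q ≋ s → p ≋ s
  ≋-trans h g = ⟨ (λ i → trans (coeff-≈ h i) (coeff-≈ g i)) ⟩

  ∷-cong : ∀ {a b p q} → a ≈ b → p ≋ q → (a ∷ p) ≋ (b ∷ q)
  ∷-cong a≈b p≋q = ⟨ (λ { zero → a≈b ; (suc i) → coeff-≈ p≋q i }) ⟩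

  ∷-injectiveʳ : ∀ {a b p q} → (a ∷ p) ≋ (b ∷ q) → p ≋ q
  ∷-injectiveʳ h = ⟨ coeff-≈ h ∘ suc ⟩

  ∷≋[]⇒≋[] : ∀ {a p} → (a ∷ p) ≋ [] → p ≋ []
  ∷≋[]⇒≋[] h = ⟨ coeff-≈ h ∘ suc ⟩

  coeff-+ₚ : ∀ p q i → coeff (p +ₚ q) i ≈ coeff p i + coeff q i
  coeff-+ₚ []      q       i       = sym (+-identityˡ _)
  coeff-+ₚ (a ∷ p) []      i       = sym (+-identityʳ _)
  coeff-+ₚ (a ∷ p) (b ∷ q) zero    = refl
  coeff-+ₚ (a ∷ p) (b ∷ q) (suc i) = coeff-+ₚ p q i

  coeff-negₚ : ∀ p i → coeff (-ₚ p) i ≈ - coeff p i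
  coeff-negₚ []      i       = sym -0#≈0#
  coeff-negₚ (a ∷ p) zero    = refl
  coeff-negₚ (a ∷ p) (suc i) = coeff-negₚ p i

  coeff-scale : ∀ a q i → coeff (L.map (a *_) q) i ≈ a * coeff q i
  coeff-scale a []      i       = sym (zeroʳ a)
  coeff-scale a (b ∷ q) zero    = refl
  coeff-scale a (b ∷ q) (suc i) = coeff-scale a q i

  +ₚ-cong : ∀ {p p' q q'} → p ≋ p' → q ≋ q' → (p +ₚ q) ≋ (p' +ₚ q')
  +ₚ-cong {p} {p'} {q} {q'} h g = ⟨ (λ i →
    trans (coeff-+ₚ p q i) (trans (+-cong (coeff-≈ h i) (coeff-≈ g i)) (sym (coeff-+ₚ p' q' i)))) ⟩

  -ₚ-cong : ∀ {p q} → p ≋ q → (-ₚ p) ≋ (-ₚ q)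
  -ₚ-cong {p} {q} h = ⟨ (λ i →
    trans (coeff-negₚ p i) (trans (-‿cong (coeff-≈ h i)) (sym (coeff-negₚ q i)))) ⟩

  scale-cong : ∀ {a b q q'} → a ≈ b → q ≋ q' → L.map (a *_) q ≋ L.map (b *_) q'
  scale-cong {a} {b} {q} {q'} a≈b h = ⟨ (λ i →
    trans (coeff-scale a q i) (trans (*-cong a≈b (coeff-≈ h i)) (sym (coeff-scale b q' i)))) ⟩

  *ₚ-congˡ : ∀ p {q q'} → q ≋ q' → (p *ₚ q) ≋ (p *ₚ q')
  *ₚ-congˡ []      h = ≋-refl
  *ₚ-congˡ (a ∷ p) h = +ₚ-cong (scale-cong refl h) (∷-cong refl (*ₚ-congˡ p h))

  *ₚ-zeroˡ : ∀ p q → p ≋ [] → (p *ₚ q) ≋ []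
  *ₚ-zeroˡ []      q h = ≋-refl
  *ₚ-zeroˡ (a ∷ p) q h = +ₚ-cong {q = 0# ∷ (p *ₚ q)} {q' = []}
    ⟨ (λ i → trans (coeff-scale a q i) (trans (*-congʳ (coeff-≈ h zero)) (zeroˡ _))) ⟩
    ⟨ (λ { zero → refl ; (suc i) → coeff-≈ (*ₚ-zeroˡ p q (∷≋[]⇒≋[] h)) i }) ⟩

  *ₚ-congʳ : ∀ {p p'} q → p ≋ p' → (p *ₚ q) ≋ (p' *ₚ q)
  *ₚ-congʳ {[]}    {[]}     q h = ≋-refl
  *ₚ-congʳ {[]}    {b ∷ p'} q h = ≋-sym (*ₚ-zeroˡ (b ∷ p') q (≋-sym h))
  *ₚ-congʳ {a ∷ p} {[]}     q h = *ₚ-zeroˡ (a ∷ p) q h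
  *ₚ-congʳ {a ∷ p} {b ∷ p'} q h =
    +ₚ-cong (scale-cong (coeff-≈ h zero) ≋-refl) (∷-cong refl (*ₚ-congʳ q (∷-injectiveʳ h)))

  *ₚ-cong : ∀ {p p' q q'} → p ≋ p' → q ≋ q' → (p *ₚ q) ≋ (p' *ₚ q')
  *ₚ-cong {p} {q' = q'} h g = ≋-trans (*ₚ-congˡ p g) (*ₚ-congʳ q' h)

  ⟦⟧ₚ-cong : ∀ {n} (e : Expr Pol n) {ρ ρ'} → Pointwise _≋_ ρ ρ' → ⟦ e ⟧ₚ ρ ≋ ⟦ e ⟧ₚ ρ'
  ⟦⟧ₚ-cong (const p) h = ≋-refl
  ⟦⟧ₚ-cong (var i)   h = Pointwise.lookup h i
  ⟦⟧ₚ-cong (e ⊕ f)   h = +ₚ-cong (⟦⟧ₚ-cong e h) (⟦⟧ₚ-cong f h)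
  ⟦⟧ₚ-cong (e ⊗ f)   h = *ₚ-cong (⟦⟧ₚ-cong e h) (⟦⟧ₚ-cong f h)
  ⟦⟧ₚ-cong (⊝ e)     h = -ₚ-cong (⟦⟧ₚ-cong e h)

  evalP-zero : ∀ {p} x → p ≋ [] → evalP p x ≈ 0#
  evalP-zero {[]}    x h = refl
  evalP-zero {a ∷ p} x h = trans
    (+-cong (coeff-≈ h zero) (trans (*-congˡ (evalP-zero x (∷≋[]⇒≋[] h))) (zeroʳ x)))
    (+-identityʳ 0#)

  evalP-cong : ∀ {p q} x → p ≋ q → evalP p x ≈ evalP q x
  evalP-cong {[]}    {[]}    x h = refl
  evalP-cong {[]}    {b ∷ q} x h = sym (evalP-zero x (≋-sym h))
  evalP-cong {a ∷ p} {[]}    x h = evalP-zero x h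
  evalP-cong {a ∷ p} {b ∷ q} x h = +-cong (coeff-≈ h zero) (*-congˡ (evalP-cong x (∷-injectiveʳ h)))

  allZero⇔≈ₚ[] : ∀ p → LA.All (_≈ 0#) p ⇔ (p ≈ₚ [])
  allZero⇔≈ₚ[] p = mk⇔ (to p) (from p)
    where
    to : ∀ p → LA.All (_≈ 0#) p → p ≈ₚ []
    to []      LA.[]        i       = refl
    to (a ∷ p) (a≈0 LA.∷ _) zero    = a≈0
    to (a ∷ p) (_ LA.∷ h)   (suc i) = to p h i
    from : ∀ p → p ≈ₚ [] → LA.All (_≈ 0#) p
    from []      h = LA.[]
    from (a ∷ p) h = h zero LA.∷ from p (h ∘ suc)

  -- Deg≤ α is definitionally Deg< (suc α).
  Deg< : ℕ → Pol → Set ℓ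
  Deg< l p = ∀ i → l ≤ i → coeff p i ≈ 0#

  length-Deg< : ∀ p {l} → length p ≤ l → Deg< l p
  length-Deg< []      h       i       _       = refl
  length-Deg< (a ∷ p) (s≤s h) (suc i) (s≤s g) = length-Deg< p h i g

  toList-Deg< : ∀ {l} (v : Vec Carrier l) → Deg< l (toList v)
  toList-Deg< []      i       _       = refl
  toList-Deg< (a ∷ v) (suc i) (s≤s h) = toList-Deg< v i h

  maxLength-Deg< : ∀ {m k} (ps : Vec Pol m) → maxLength ps ≤ k → Pointwise Deg< (V.replicate m k) ps
  maxLength-Deg< []       h = []
  maxLength-Deg< (p ∷ ps) h =
    length-Deg< p (≤-trans (m≤m⊔n _ _) h) ∷ maxLength-Deg< ps (≤-trans (m≤n⊔m (length p) _) h)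

  chunks-Deg< : ∀ {k} (ls : Vec ℕ k) w → Pointwise Deg< ls (chunks ls w)
  chunks-Deg< []       w = []
  chunks-Deg< (l ∷ ls) w = toList-Deg< (V.take l w) ∷ chunks-Deg< ls (V.drop l w)

  pad-≋ : ∀ {l p} → Deg< l p → toList (pad 0# l p) ≋ p
  pad-≋ {zero}  {p}     d = ⟨ (λ i → sym (d i z≤n)) ⟩
  pad-≋ {suc l} {[]}    d = ⟨ (λ { zero → refl ; (suc i) → coeff-≈ (pad-≋ {l} {[]} (λ _ _ → refl)) i }) ⟩
  pad-≋ {suc l} {a ∷ p} d = ∷-cong refl (pad-≋ (λ i h → d (suc i) (s≤s h)))

  chunks-pack : ∀ {k} {ls : Vec ℕ k} {ps} → Pointwise Deg< ls ps → Pointwise _≋_ (chunks ls (pack 0# ls ps)) ps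
  chunks-pack {ls = []}     {[]}     []       = []
  chunks-pack {ls = l ∷ ls} {p ∷ ps} (d ∷ ds)
    rewrite take-++ (pad 0# l p) (pack 0# ls ps) | drop-++ (pad 0# l p) (pack 0# ls ps)
    = pad-≋ d ∷ chunks-pack ds

  module Symbolic {n : ℕ} where

    SPol : Set c
    SPol = List (Expr Carrier n)

    _+ₛ_ : SPol → SPol → SPol
    []      +ₛ q       = q
    (a ∷ p) +ₛ []      = a ∷ p
    (a ∷ p) +ₛ (b ∷ q) = (a ⊕ b) ∷ (p +ₛ q)

    _*ₛ_ : SPol → SPol → SPol
    []      *ₛ q = []
    (a ∷ p) *ₛ q = L.map (a ⊗_) q +ₛ (const 0# ∷ (p *ₛ q))

    evalₛ : SPol → Expr Carrier n → Expr Carrier n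
    evalₛ []      x = const 0#
    evalₛ (a ∷ p) x = a ⊕ (x ⊗ evalₛ p x)

    expand : ∀ {k} → Vec SPol k → Expr Pol k → SPol
    expand σ (const p) = L.map const p
    expand σ (var i)   = lookup σ i
    expand σ (e ⊕ f)   = expand σ e +ₛ expand σ f
    expand σ (e ⊗ f)   = expand σ e *ₛ expand σ f
    expand σ (⊝ e)     = L.map ⊝_ (expand σ e)

    module _ (ρ : Vec Carrier n) where
      private
        ev : Expr Carrier n → Carrier
        ev = evalExpr ρ

      map-+ₛ : ∀ p q → L.map ev (p +ₛ q) ≡ L.map ev p +ₚ L.map ev q
      map-+ₛ []      q       = ≡.refl
      map-+ₛ (a ∷ p) []      = ≡.refl
      map-+ₛ (a ∷ p) (b ∷ q) = ≡.cong (_ ∷_) (map-+ₛ p q)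

      map-*ₛ : ∀ p q → L.map ev (p *ₛ q) ≡ L.map ev p *ₚ L.map ev q
      map-*ₛ []      q = ≡.refl
      map-*ₛ (a ∷ p) q = ≡.trans (map-+ₛ (L.map (a ⊗_) q) (const 0# ∷ (p *ₛ q)))
        (≡.cong₂ _+ₚ_ (≡.trans (≡.sym (LP.map-∘ q)) (LP.map-∘ q)) (≡.cong (0# ∷_) (map-*ₛ p q)))

      evalₛ-correct : ∀ p x → ev (evalₛ p x) ≡ evalP (L.map ev p) (ev x)
      evalₛ-correct []      x = ≡.refl
      evalₛ-correct (a ∷ p) x = ≡.cong (λ t → ev a + ev x * t) (evalₛ-correct p x)

      expand-correct : ∀ {k} (σ : Vec SPol k) e → L.map ev (expand σ e) ≡ ⟦ e ⟧ₚ (V.map (L.map ev) σ)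
      expand-correct σ (const p) = ≡.trans (≡.sym (LP.map-∘ p)) (LP.map-id p)
      expand-correct σ (var i)   = ≡.sym (VP.lookup-map i (L.map ev) σ)
      expand-correct σ (e ⊕ f)   = ≡.trans (map-+ₛ (expand σ e) (expand σ f))
        (≡.cong₂ _+ₚ_ (expand-correct σ e) (expand-correct σ f))
      expand-correct σ (e ⊗ f)   = ≡.trans (map-*ₛ (expand σ e) (expand σ f))
        (≡.cong₂ _*ₚ_ (expand-correct σ e) (expand-correct σ f))
      expand-correct σ (⊝ e)     = ≡.trans (≡.trans (≡.sym (LP.map-∘ (expand σ e))) (LP.map-∘ (expand σ e)))
        (≡.cong -ₚ_ (expand-correct σ e))

  Solves : ∀ {k r} → Vec (Expr Pol k) r → Vec Pol k → Set (c ⊔ ℓ)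
  Solves F fs = VA.All (λ G → ⟦ G ⟧ₚ fs ≈ₚ []) F

  Solves-cong : ∀ {k r} (F : Vec (Expr Pol k) r) {fs gs} → Pointwise _≋_ gs fs → Solves F fs → Solves F gs
  Solves-cong F {fs} gs≋fs = VA.map {P = λ G → ⟦ G ⟧ₚ fs ≈ₚ []} (λ {G} h → coeff-≈ (≋-trans {s = []} (⟦⟧ₚ-cong G gs≋fs) ⟨ h ⟩))

  BoundedZeros : ∀ {m r} → Vec (Expr Pol (suc m)) r → ℕ → Vec ℕ m → Carrier → Set (c ⊔ ℓ)
  BoundedZeros {m} F l ls x = Σ Pol λ f → Σ (Vec Pol m) λ bs →
    Deg< l f × Pointwise Deg< ls bs × Solves F (f ∷ bs) × evalP f x ≈ 0#

  module _ {m r} (F : Vec (Expr Pol (suc m)) r) (l : ℕ) (ls : Vec ℕ m) where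
    -- Variable 0 stands for the point x, the others for the coefficients of f, b₁, …, bₘ.
    open Symbolic {suc (V.sum (l ∷ ls))}

    σ : Vec SPol (suc m)
    σ = chunks (l ∷ ls) (V.tabulate (var ∘ Fin.suc))

    equations : List (Expr Carrier (suc (V.sum (l ∷ ls))))
    equations = evalₛ (V.head σ) (var Fin.zero) ∷ L.concatMap (expand σ) (toList F)

    σ-correct : ∀ x w → V.map (L.map (evalExpr (x ∷ w))) σ ≡ chunks (l ∷ ls) w
    σ-correct x w = ≡.trans (chunks-map (evalExpr (x ∷ w)) (l ∷ ls) _)
      (≡.cong (chunks (l ∷ ls)) (≡.trans (≡.sym (VP.tabulate-∘ (evalExpr (x ∷ w)) (var ∘ Fin.suc)))
                                          (VP.tabulate∘lookup w)))

    equation⇔ : ∀ x w G → LA.All (Vanishes (x ∷ w)) (expand σ G) ⇔ (⟦ G ⟧ₚ (chunks (l ∷ ls) w) ≈ₚ [])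
    equation⇔ x w G = mk⇔
      (λ h → ≡.subst (_≈ₚ []) expanded (Equivalence.to (allZero⇔≈ₚ[] _) (LAP.map⁺ h)))
      (λ h → LAP.map⁻ (Equivalence.from (allZero⇔≈ₚ[] _) (≡.subst (_≈ₚ []) (≡.sym expanded) h)))
      where
      expanded : L.map (evalExpr (x ∷ w)) (expand σ G) ≡ ⟦ G ⟧ₚ (chunks (l ∷ ls) w)
      expanded = ≡.trans (expand-correct (x ∷ w) σ G) (≡.cong ⟦ G ⟧ₚ (σ-correct x w))

    equations⇔ : ∀ x w → LA.All (Vanishes (x ∷ w)) equations ⇔
      (evalP (toList (V.take l w)) x ≈ 0# × Solves F (chunks (l ∷ ls) w))
    equations⇔ x w = mk⇔
      (λ { (z LA.∷ h) → ≡.subst (_≈ 0#) at-x z ,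
            VA.map (λ {G} → Equivalence.to (equation⇔ x w G)) (VAP.toList⁻ (LAP.map⁻ (LAP.concat⁻ h))) })
      (λ { (z , h) → ≡.subst (_≈ 0#) (≡.sym at-x) z LA.∷
            LAP.concat⁺ (LAP.map⁺ (VAP.toList⁺ (VA.map (λ {G} → Equivalence.from (equation⇔ x w G)) h))) })
      where
      at-x : evalExpr (x ∷ w) (evalₛ (V.head σ) (var Fin.zero)) ≡ evalP (toList (V.take l w)) x
      at-x = ≡.trans (evalₛ-correct (x ∷ w) (V.head σ) (var Fin.zero))
        (≡.cong (λ p → evalP p x) (≡.cong V.head (σ-correct x w)))

    EquationsSolvable : Carrier → Set (c ⊔ ℓ)
    EquationsSolvable x = Σ (Vec Carrier (V.sum (l ∷ ls))) λ w → VA.All (Vanishes (x ∷ w)) (V.fromList equations)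

    equationsSolvable⇒boundedZeros : ∀ x → EquationsSolvable x → BoundedZeros F l ls x
    equationsSolvable⇒boundedZeros x (w , h) =
      let (z , solves) = Equivalence.to (equations⇔ x w) (VAP.fromList⁻ h)
      in toList (V.take l w) , chunks ls (V.drop l w) ,
         toList-Deg< (V.take l w) , chunks-Deg< ls (V.drop l w) , solves , z

    boundedZeros⇒equationsSolvable : ∀ x → BoundedZeros F l ls x → EquationsSolvable x
    boundedZeros⇒equationsSolvable x (f , bs , d , ds , solves , z) =
      w , VAP.fromList⁺ (Equivalence.from (equations⇔ x w)
            (trans (evalP-cong x (Pointwise.head packed)) z , Solves-cong F packed solves))
      where
      w = pack 0# (l ∷ ls) (f ∷ bs)
      packed : Pointwise _≋_ (chunks (l ∷ ls) w) (f ∷ bs)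
      packed = chunks-pack (d ∷ ds)

    boundedZeros-diophantine : Diophantine₁ rawRing (BoundedZeros F l ls)
    boundedZeros-diophantine = V.sum (l ∷ ls) , L.length equations , V.fromList equations ,
      λ { (x ∷ []) → mk⇔ (boundedZeros⇒equationsSolvable x) (equationsSolvable⇒boundedZeros x) }

  module _ {m r} {D : Pol → Set (c ⊔ ℓ)} (F : Vec (Expr Pol (suc m)) r)
    (presentation : ∀ f → D f ⇔ Σ (Vec Pol m) λ bs → Solves F (f ∷ bs)) where

    zeroTrunc⇔boundedZeros : ∀ α a → Zero (Trunc D α) a ⇔ Σ ℕ λ k → BoundedZeros F (suc α) (V.replicate m k) a
    zeroTrunc⇔boundedZeros α a = mk⇔
      (λ { (f , (df , deg) , z) → let (bs , solves) = Equivalence.to (presentation f) df in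
           maxLength bs , f , bs , deg , maxLength-Deg< bs ≤-refl , solves , z })
      (λ { (_ , f , bs , deg , _ , solves , z) → f , (Equivalence.from (presentation f) (bs , solves) , deg) , z })

    zero⇔boundedZeros : ∀ a → Zero D a ⇔ Σ ℕ λ k → BoundedZeros F k (V.replicate m k) a
    zero⇔boundedZeros a = mk⇔
      (λ { (f , df , z) → let (bs , solves) = Equivalence.to (presentation f) df in
           maxLength (f ∷ bs) , f , bs , length-Deg< f (m≤m⊔n _ _) , maxLength-Deg< bs (m≤n⊔m (length f) _) ,
           solves , z })
      (λ { (_ , f , bs , _ , _ , solves , z) → f , Equivalence.from (presentation f) (bs , solves) , z })

  unionOfDiophantine : ∀ {p} {Y : Carrier → Set p} (X : ℕ → Carrier → Set (c ⊔ ℓ)) →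
    (∀ k → Diophantine₁ rawRing (X k)) → (∀ a → Y a ⇔ Σ ℕ λ k → X k a) → CountableUnionOfDiophantine Y
  unionOfDiophantine X dioph Y⇔ = (λ _ → ⊤) , X , (λ k _ → dioph k) , λ a → mk⇔
    (λ y → let (k , x) = Equivalence.to (Y⇔ a) y in k , tt , x)
    (λ { (k , _ , x) → Equivalence.from (Y⇔ a) (k , x) })

corollary1p3 : ∀ {c ℓ} (A : CommutativeRing c ℓ) →
    (D : List (CommutativeRing.Carrier A) → Set (c ⊔ ℓ)) →
    Diophantine₁ (Poly.A[z] A) D →
    (α : ℕ) →
    Poly.CountableUnionOfDiophantine A (Poly.Zero A (Poly.Trunc A D α))
    × Poly.CountableUnionOfDiophantine A (Poly.Zero A D)
corollary1p3 A D (m , r , F , D⇔) α =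
    unionOfDiophantine (λ k → BoundedZeros F (suc α) (V.replicate m k))
      (λ k → boundedZeros-diophantine F (suc α) _) (zeroTrunc⇔boundedZeros F presentation α)
  , unionOfDiophantine (λ k → BoundedZeros F k (V.replicate m k))
      (λ k → boundedZeros-diophantine F k _) (zero⇔boundedZeros F presentation)
  where
  open ZeroSets A
  presentation : ∀ f → D f ⇔ Σ (Vec (List (CommutativeRing.Carrier A)) m) λ bs → Solves F (f ∷ bs)
  presentation f = D⇔ (f ∷ [])
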